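{- For every $\mathrm{k}\in\mathbb{N}$, the following problem (EL-k Step Persistence Problem) is decidable: given a place/transition net $\mathrm{S}=(P,T,F,M_0)$, a marking $M\in\mathbb{N}^P$ and a transition $a\in T$ enabled in $M$, decide whether the step $Ma$ is e/l-$\mathrm{k}$-persistent.
   Context: A place/transition net (p/t-net) is $\mathrm{S}=(P,T,F,M_0)$ where $P$ (places) and $T$ (transitions) are finite disjoint sets, $F\subseteq P\times T\cup T\times P$ is the flow relation, and $M_0\in\mathbb{N}^P$ is the initial marking. Markings are vectors in $\mathbb{N}^P$, ordered and added componentwise. For $a\in T$, ${}^\bullet a\in\mathbb{N}^P$ is the vector with $1$ at places $p$ with $(p,a)\in F$ and $0$ elsewhere; $a^\bullet$ is the vector with $1$ at places $p$ with $(a,p)\in F$ and $0$ elsewhere. A transition $a$ is enabled in $M$ (written $Ma$) iff ${}^\bullet a\le M$; then firing $a$ yields $M'=(M-{}^\bullet a)+a^\bullet$ (written $MaM'$). This is extended to strings $w\in T^*$: $M\varepsilon M$, and $MvaM''$ iff $MvM'$ and $M'aM''$ for some $M'$; $Mw$ means $MwM'$ for some $M'$. For $\mathrm{k}\in\mathbb{N}$, a step $Ma$ (with $a$ enabled in $M$) is e/l-$\mathrm{k}$-persistent iff for every $b\in T$, $b\neq a$, $Mb$ implies that there exists $w\in T^*$ with $|w|\le\mathrm{k}$ and $Mawb$. -}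

module Defs where

open import Data.Nat using (ℕ; _≤_; _∸_; _+_)
open import Data.Fin using (Fin)
open import Data.Bool using (Bool; if_then_else_)
open import Data.List using (List; []; _∷_; _++_; [_]; length)
open import Data.Product using (Σ; ∃; _×_)
open import Relation.Binary.PropositionalEquality using (_≢_)

-- A place/transition net S = (P, T, F, M₀) with finite P = Fin nP and
-- T = Fin nT (disjoint by construction).  The flow relation
-- F ⊆ P×T ∪ T×P is given by its two (decidable) components.
record Net : Set where
  field
    nP   : ℕ
    nT   : ℕ
    Fin→ : Fin nP → Fin nT → Bool
    Fout : Fin nT → Fin nP → Bool
    M₀   : Fin nP → ℕ

module _ (S : Net) where
  open Net S

  Place Transition Marking : Set
  Place = Fin nP
  Transition = Fin nT
  Marking = Place → ℕ

  pre : Transition → Marking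
  pre a p = if Fin→ p a then 1 else 0

  post : Transition → Marking
  post a p = if Fout a p then 1 else 0

  Enabled : Marking → Transition → Set
  Enabled M a = ∀ p → pre a p ≤ M p

  fire : Marking → Transition → Marking
  fire M a p = (M p ∸ pre a p) + post a p

  data Fires : Marking → List Transition → Marking → Set where
    ε-fire : ∀ {M} → Fires M [] M
    ∷-fire : ∀ {M a w M'} → Enabled M a → Fires (fire M a) w M' → Fires M (a ∷ w) M'

  Fireable : Marking → List Transition → Set
  Fireable M w = ∃ λ M' → Fires M w M'

  ELPersistent : ℕ → Marking → Transition → Set
  ELPersistent k M a =
    ∀ (b : Transition) → b ≢ a → Enabled M b →
      Σ (List Transition) λ w → length w ≤ k × Fireable M (a ∷ w ++ [ b ])

-- Everything in the definition of e/l-k-persistence ranges over finite,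
-- decidable data: the transitions b are finitely many, enabledness is a
-- finite conjunction of comparisons in ℕ, firing a fixed string is a
-- deterministic computation, and there are only finitely many strings over T
-- of length at most k.  Hence the defining formula can be evaluated.
module Submission where

open import Defs
open import Data.Nat using (ℕ; zero; suc; _≤_; _≤?_; z≤n; s≤s)
open import Data.Fin using (Fin)
open import Data.Fin.Properties using (all?; any?; _≟_)
open import Data.List using (List; []; _∷_; _++_; [_]; length)
open import Data.Product using (Σ; ∃; _×_; _,_)
open import Data.Sum using (_⊎_; inj₁; inj₂)
open import Relation.Nullary using (Dec; yes; ¬?; _×-dec_; _⊎-dec_; _→-dec_; map′)

module _ {n : ℕ} where

  ShortWitness : (List (Fin n) → Set) → ℕ → Set
  ShortWitness P k = Σ (List (Fin n)) λ w → length w ≤ k × P w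

  shortWitness-suc : ∀ {P k} → P [] ⊎ ∃ (λ t → ShortWitness (λ w → P (t ∷ w)) k) →
    ShortWitness P (suc k)
  shortWitness-suc (inj₁ p)               = [] , z≤n , p
  shortWitness-suc (inj₂ (t , w , l , p)) = t ∷ w , s≤s l , p

  shortWitness-suc⁻ : ∀ {P k} → ShortWitness P (suc k) →
    P [] ⊎ ∃ (λ t → ShortWitness (λ w → P (t ∷ w)) k)
  shortWitness-suc⁻ ([] , _ , p)         = inj₁ p
  shortWitness-suc⁻ (t ∷ w , s≤s l , p) = inj₂ (t , w , l , p)

  shortWitness? : ∀ {P} → (∀ w → Dec (P w)) → (k : ℕ) → Dec (ShortWitness P k)
  shortWitness? P? zero    = map′ (λ p → [] , z≤n , p) (λ { ([] , _ , p) → p }) (P? [])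
  shortWitness? P? (suc k) = map′ shortWitness-suc shortWitness-suc⁻
    (P? [] ⊎-dec any? λ t → shortWitness? (λ w → P? (t ∷ w)) k)

module _ (S : Net) where

  enabled? : (M : Marking S) (a : Transition S) → Dec (Enabled S M a)
  enabled? M a = all? λ p → pre S a p ≤? M p

  fireable-∷ : ∀ {M a w} → Enabled S M a → Fireable S (fire S M a) w → Fireable S M (a ∷ w)
  fireable-∷ e (M' , f) = M' , ∷-fire e f

  fireable-∷⁻ : ∀ {M a w} → Fireable S M (a ∷ w) → Enabled S M a × Fireable S (fire S M a) w
  fireable-∷⁻ (M' , ∷-fire e f) = e , (M' , f)

  fireable? : (M : Marking S) (w : List (Transition S)) → Dec (Fireable S M w)
  fireable? M []      = yes (M , ε-fire)
  fireable? M (a ∷ w) =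
    map′ (λ (e , f) → fireable-∷ e f) fireable-∷⁻ (enabled? M a ×-dec fireable? (fire S M a) w)

theorem3 : (k : ℕ) (S : Net) (M : Marking S) (a : Transition S) →
    Enabled S M a → Dec (ELPersistent S k M a)
theorem3 k S M a _ =
  all? λ b → ¬? (b ≟ a) →-dec (enabled? S M b →-dec
    shortWitness? (λ w → fireable? S M (a ∷ w ++ [ b ])) k)
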